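{- The CI frames $\mathfrak{P}$ (discrete probabilistic), $\mathfrak{S}^{\mathrm{str}}$ (structural semi-graphoids), and $\mathfrak{S}$ (semi-graphoids) are closed under lifting.
   Context: For a finite set $N$, $\mathbb{S}(N)$ denotes the set of all CI statements $ij|K$ with $i,j\in N$ distinct and $K\subseteq N\setminus\{i,j\}$, with $ij|K$ and $ji|K$ identified; juxtaposition denotes union. A CI model over $N$ is a subset of $\mathbb{S}(N)$. A CI frame $\mathfrak{F}$ assigns to every finite set $N$ a set $\mathfrak{F}(N)$ of models over $N$ with $\mathbb{S}(N)\in\mathfrak{F}(N)$. $\mathfrak{P}(N)$: models $\mathcal{M}_\xi=\{ij|K: p_{ijK}(x)p_K(x)=p_{iK}(x)p_{jK}(x)\ \forall x\}$ induced by discrete random vectors $\xi$ over $N$ (each component with finite nonempty sample space, $p_I(x)$ the probability that $\xi_i=x_i$ for $i\in I$). $\mathfrak{S}^{\mathrm{str}}(N)$: models $\{ij|K:\Delta m(ij|K)=0\}$ for supermodular $m:\mathcal{P}(N)\to\mathbb{R}$, where $\Delta m(ij|K)=m(ijK)+m(K)-m(iK)-m(jK)$ and supermodular means $m(A\cup B)+m(A\cap B)\ge m(A)+m(B)$. $\mathfrak{S}(N)$: semi-graphoids, i.e. $\mathcal{M}\subseteq\mathbb{S}(N)$ such that for distinct $i,j,\ell$ and $K\subseteq N\setminus\{i,j,\ell\}$: $ij|K,\ i\ell|jK\in\mathcal{M}\iff i\ell|K,\ ij|\ell K\in\mathcal{M}$. For $N\subseteq O$ and $\mathcal{M}\subseteq\mathbb{S}(N)$,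 the lift of $\mathcal{M}$ to $O$ is $\mathcal{M}_{N\uparrow O}=\{ij|K\in\mathbb{S}(O): \{i,j\}\cap(O\setminus N)\ne\emptyset \text{ or } ij|(K\cap N)\in\mathcal{M}\}$. A frame $\mathfrak{F}$ is closed under lifting if $\mathcal{M}\in\mathfrak{F}(N)$ and $N\subseteq O$ imply $\mathcal{M}_{N\uparrow O}\in\mathfrak{F}(O)$. -}

module Defs where

open import Level using (0ℓ)
open import Data.Nat using (ℕ; zero; suc)
open import Data.Fin using (Fin; zero; suc; _≟_)
open import Data.Fin.Subset using (Subset; ⁅_⁆; _∪_; _∩_; _∉_)
open import Data.Vec using (lookup; tabulate)
open import Data.Bool using (Bool; true; false; if_then_else_; _∧_)
open import Data.List using (List; []; _∷_; [_]; map; concatMap; allFin; foldr)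
open import Data.Product using (Σ; ∃; ∃₂; _×_; _,_)
open import Data.Sum using (_⊎_)
open import Relation.Nullary using (¬_; ⌊_⌋)
open import Relation.Binary.PropositionalEquality using (_≡_; _≢_)
open import Relation.Binary.Structures using (IsTotalOrder)
open import Algebra.Structures using (IsCommutativeRing)
open import Function.Definitions using (Injective)
open import Function.Bundles using (_⇔_)

-- The real numbers, axiomatised as a complete ordered field
-- (any model is isomorphic to ℝ).

record RealField : Set₁ where
  infixl 6 _+_
  infixl 7 _*_
  infix 4 _≤_
  field
    Carrier : Set
    _+_ _*_ : Carrier → Carrier → Carrier
    -_      : Carrier → Carrier
    0# 1#   : Carrier
    _≤_     : Carrier → Carrier → Set
    isCommutativeRing : IsCommutativeRing _≡_ _+_ _*_ -_ 0# 1#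
    0≢1     : 0# ≢ 1#
    inverse : ∀ x → x ≢ 0# → ∃ λ y → x * y ≡ 1#
    isTotalOrder : IsTotalOrder _≡_ _≤_
    +-mono  : ∀ x y z → x ≤ y → x + z ≤ y + z
    *-nonneg : ∀ x y → 0# ≤ x → 0# ≤ y → 0# ≤ x * y
    complete : (P : Carrier → Set) → ∃ P →
               (∃ λ b → ∀ x → P x → x ≤ b) →
               ∃ λ s → (∀ x → P x → x ≤ s) ×
                       (∀ b → (∀ x → P x → x ≤ b) → s ≤ b)

-- CI statements and models over the finite set Fin n.
-- A model is a predicate on triples (i , j , K); only valid triples
-- (i ≢ j, i,j ∉ K) are meaningful; ij|K and ji|K are identified.

Model : ℕ → Set₁
Model n = Fin n → Fin n → Subset n → Set

Valid : ∀ {n} → Fin n → Fin n → Subset n → Set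
Valid i j K = i ≢ j × i ∉ K × j ∉ K

Frame : Set₁
Frame = (n : ℕ) → Model n → Set

-- Lifting along N ⊆ O, where N = Fin m is embedded into O = Fin n by an
-- injection ι (N is identified with the image of ι).

preimage : ∀ {m n} → (Fin m → Fin n) → Subset n → Subset m
preimage ι K = tabulate (λ a → lookup K (ι a))

InImage : ∀ {m n} → (Fin m → Fin n) → Fin n → Set
InImage ι i = ∃ λ a → ι a ≡ i

lift : ∀ {m n} → (Fin m → Fin n) → Model m → Model n
lift ι M i j K =
  (¬ InImage ι i ⊎ ¬ InImage ι j) ⊎
  (∃₂ λ i' j' → ι i' ≡ i × ι j' ≡ j × M i' j' (preimage ι K))

ClosedUnderLifting : Frame → Set₁
ClosedUnderLifting 𝔉 =
  ∀ m n (ι : Fin m → Fin n) → Injective _≡_ _≡_ ι →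
  ∀ (M : Model m) → 𝔉 m M → 𝔉 n (lift ι M)

𝔖 : Frame
𝔖 n M =
  (∀ i j K → Valid i j K → M i j K → M j i K) ×
  (∀ i j l K → i ≢ j → i ≢ l → j ≢ l → i ∉ K → j ∉ K → l ∉ K →
     (M i j K × M i l (⁅ j ⁆ ∪ K)) ⇔ (M i l K × M i j (⁅ l ⁆ ∪ K)))

module _ (ℝ : RealField) where
  open RealField ℝ

  Δ : ∀ {n} → (Subset n → Carrier) → Fin n → Fin n → Subset n → Carrier
  Δ m i j K = (m (⁅ i ⁆ ∪ ⁅ j ⁆ ∪ K) + m K) + - (m (⁅ i ⁆ ∪ K) + m (⁅ j ⁆ ∪ K))

  Supermodular : ∀ {n} → (Subset n → Carrier) → Set
  Supermodular m = ∀ A B → m A + m B ≤ m (A ∪ B) + m (A ∩ B)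

  𝔖str : Frame
  𝔖str n M = ∃ λ (m : Subset n → Carrier) → Supermodular m ×
    (∀ i j K → Valid i j K → M i j K ⇔ (Δ m i j K ≡ 0#))

  -- Discrete random vectors: component i has sample space
  -- Fin (suc (k i)) (finite, nonempty); p is the joint mass function.

  Config : (n : ℕ) → (Fin n → ℕ) → Set
  Config n k = (i : Fin n) → Fin (suc (k i))

  allConfigs : (n : ℕ) (k : Fin n → ℕ) → List (Config n k)
  allConfigs zero k = [ (λ ()) ]
  allConfigs (suc n) k =
    concatMap (λ a → map (cons a) (allConfigs n (λ i → k (suc i))))
              (allFin (suc (k zero)))
    where
    cons : Fin (suc (k zero)) → Config n (λ i → k (suc i)) → Config (suc n) k
    cons a rest zero = a
    cons a rest (suc i) = rest i

  sumR : List Carrier → Carrier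
  sumR = foldr _+_ 0#

  agreeOn : ∀ {n k} → Subset n → Config n k → Config n k → Bool
  agreeOn {n} I x y =
    foldr _∧_ true (map (λ i → if lookup I i then ⌊ x i ≟ y i ⌋ else true) (allFin n))

  record RandomVector (n : ℕ) : Set where
    field
      k     : Fin n → ℕ
      p     : Config n k → Carrier
      p≥0   : ∀ x → 0# ≤ p x
      sum≡1 : sumR (map p (allConfigs n k)) ≡ 1#

  marginal : ∀ {n} (ξ : RandomVector n) → Subset n →
             Config n (RandomVector.k ξ) → Carrier
  marginal {n} ξ I x =
    sumR (map (λ y → if agreeOn I x y then p y else 0#) (allConfigs n k))
    where open RandomVector ξ

  CI : ∀ {n} → RandomVector n → Fin n → Fin n → Subset n → Set
  CI ξ i j K = ∀ x →
    marginal ξ (⁅ i ⁆ ∪ ⁅ j ⁆ ∪ K) x * marginal ξ K x ≡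
    marginal ξ (⁅ i ⁆ ∪ K) x * marginal ξ (⁅ j ⁆ ∪ K) x

  𝔓 : Frame
  𝔓 n M = ∃ λ (ξ : RandomVector n) →
    ∀ i j K → Valid i j K → M i j K ⇔ CI ξ i j K

-- A statement ij|K of a lifted model that mentions a new element holds
-- automatically, and one that does not is the original statement with K
-- replaced by its preimage K ∩ N.  Hence the semi-graphoid axioms transfer
-- case by case.  A structural model of μ lifts to the structural model of
-- μ(K ∩ N), and a random vector lifts by adjoining constant components, whose
-- marginals are p_{K ∩ N}.  In both cases every set function X ↦ F(X ∩ N)
-- makes statements with a new element hold trivially: the defining identity
-- Q(F ijK, F K, F iK, F jK) collapses to Q(u, v, v, u) or Q(u, v, u, v), i.e.
-- u + v − (v + u) = 0, resp. u·v = v·u.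
module Submission where

open import Defs
open import Level using (0ℓ)
open import Data.Nat using (ℕ; zero; suc)
open import Data.Fin using (Fin; zero; suc; _≟_; toℕ; cast)
open import Data.Fin.Properties using (any?; toℕ-injective; toℕ-cast)
open import Data.Fin.Subset using (Subset; ⁅_⁆; _∪_; _∩_; _∉_; ⊤; ⊥)
open import Data.Fin.Subset.Properties using (∪-identityˡ)
open import Data.Vec using (Vec; lookup; tabulate; replicate; zipWith)
open import Data.Vec.Properties
  using (lookup∘tabulate; lookup-zipWith; lookup-replicate; []=⇒lookup; lookup⇒[]=)
open import Data.Vec.Relation.Binary.Pointwise.Extensional using (ext; Pointwise-≡⇒≡)
open import Data.Bool using (Bool; true; false; T; if_then_else_; _∨_; _∧_)
open import Data.Bool.Properties using (T-≡; T-∧)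
open import Data.Unit using (tt)
open import Data.List using (List; []; _∷_; _++_; map; concatMap; foldr; allFin)
open import Data.List.Properties using (map-++; map-cong; map-∘; map-tabulate)
open import Data.List.Relation.Unary.All.Properties using (all⁺; all⁻; tabulate⁺; tabulate⁻)
open import Data.Product using (_×_; _,_)
open import Data.Sum using (inj₁; inj₂)
open import Data.Empty using (⊥-elim)
open import Function using (_∘_; id; const)
open import Function.Bundles using (_⇔_; mk⇔; Equivalence)
open import Function.Definitions using (Injective)
open import Function.Properties.Equivalence using () renaming (trans to ⇔-trans; sym to ⇔-sym)
open import Relation.Nullary using (¬_; Dec; yes; no; ⌊_⌋; does)
open import Relation.Nullary.Decidable using (dec-true; dec-false; toWitness; fromWitness; ⌊⌋-map′)
open import Relation.Unary using (Decidable)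
open import Relation.Binary.PropositionalEquality
open import Relation.Binary.Structures using (IsTotalOrder)
open import Algebra.Bundles using (CommutativeSemigroup)
open import Algebra.Structures using (IsCommutativeMonoid; IsCommutativeRing)
import Algebra.Properties.CommutativeSemigroup as CommutativeSemigroupProperties

lookup-ext : ∀ {A : Set} {n} {u v : Vec A n} → (∀ i → lookup u i ≡ lookup v i) → u ≡ v
lookup-ext h = Pointwise-≡⇒≡ (ext h)

lookup-⁅⁆ : ∀ {n} (i j : Fin n) → lookup ⁅ i ⁆ j ≡ does (i ≟ j)
lookup-⁅⁆ zero    zero    = refl
lookup-⁅⁆ zero    (suc j) = lookup-replicate j false
lookup-⁅⁆ (suc i) zero    = refl
lookup-⁅⁆ (suc i) (suc j) = lookup-⁅⁆ i j

T-injective : ∀ {b c} → (T b ⇔ T c) → b ≡ c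
T-injective {true}  {true}  _   = refl
T-injective {true}  {false} T⇔T = ⊥-elim (Equivalence.to T⇔T tt)
T-injective {false} {true}  T⇔T = ⊥-elim (Equivalence.from T⇔T tt)
T-injective {false} {false} _   = refl

T-if-⌊⌋ : ∀ b {P : Set} (P? : Dec P) → T (if b then ⌊ P? ⌋ else true) ⇔ (T b → P)
T-if-⌊⌋ true  P? = mk⇔ (λ t _ → toWitness t) (λ h → fromWitness (h tt))
T-if-⌊⌋ false P? = mk⇔ (λ _ ()) (const tt)

module ListSum {A : Set} {_∙_ : A → A → A} {ε : A}
               (isCommutativeMonoid : IsCommutativeMonoid _≡_ _∙_ ε) where
  open IsCommutativeMonoid isCommutativeMonoid using (assoc; identityˡ; identityʳ; isCommutativeSemigroup)

  commutativeSemigroup : CommutativeSemigroup 0ℓ 0ℓ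
  commutativeSemigroup = record { isCommutativeSemigroup = isCommutativeSemigroup }

  open CommutativeSemigroupProperties commutativeSemigroup using (interchange)
  open ≡-Reasoning

  sum : List A → A
  sum = foldr _∙_ ε

  sum-++ : ∀ xs ys → sum (xs ++ ys) ≡ sum xs ∙ sum ys
  sum-++ []       ys = sym (identityˡ (sum ys))
  sum-++ (x ∷ xs) ys = trans (cong (x ∙_) (sum-++ xs ys)) (sym (assoc x (sum xs) (sum ys)))

  sum-concatMap : ∀ {B C : Set} (f : B → List C) (F : C → A) xs →
                  sum (map F (concatMap f xs)) ≡ sum (map (λ x → sum (map F (f x))) xs)
  sum-concatMap f F []       = refl
  sum-concatMap f F (x ∷ xs) = begin
    sum (map F (f x ++ concatMap f xs))              ≡⟨ cong sum (map-++ F (f x) (concatMap f xs)) ⟩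
    sum (map F (f x) ++ map F (concatMap f xs))      ≡⟨ sum-++ (map F (f x)) (map F (concatMap f xs)) ⟩
    sum (map F (f x)) ∙ sum (map F (concatMap f xs)) ≡⟨ cong (sum (map F (f x)) ∙_) (sum-concatMap f F xs) ⟩
    sum (map F (f x)) ∙ sum (map (λ x → sum (map F (f x))) xs) ∎

  sum-ε : ∀ {B : Set} (xs : List B) → sum (map (const ε) xs) ≡ ε
  sum-ε []       = refl
  sum-ε (x ∷ xs) = trans (cong (ε ∙_) (sum-ε xs)) (identityʳ ε)

  sum-∙ : ∀ {B : Set} (f g : B → A) xs →
          sum (map (λ x → f x ∙ g x) xs) ≡ sum (map f xs) ∙ sum (map g xs)
  sum-∙ f g []       = sym (identityʳ ε)
  sum-∙ f g (x ∷ xs) = trans (cong ((f x ∙ g x) ∙_) (sum-∙ f g xs)) (interchange (f x) (g x) _ _)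

  sum-swap : ∀ {B C : Set} (F : B → C → A) xs ys →
             sum (map (λ x → sum (map (F x) ys)) xs) ≡ sum (map (λ y → sum (map (λ x → F x y) xs)) ys)
  sum-swap F []       ys = sym (sum-ε ys)
  sum-swap F (x ∷ xs) ys = trans (cong (sum (map (F x) ys) ∙_) (sum-swap F xs ys))
                                 (sym (sum-∙ (F x) (λ y → sum (map (λ x → F x y) xs)) ys))

_≐_ : ∀ {n} → Model n → Model n → Set
M ≐ M′ = ∀ i j K → Valid i j K → M i j K ⇔ M′ i j K

≐-trans : ∀ {n} {M₁ M₂ M₃ : Model n} → M₁ ≐ M₂ → M₂ ≐ M₃ → M₁ ≐ M₃
≐-trans M₁≐M₂ M₂≐M₃ i j K v = ⇔-trans (M₁≐M₂ i j K v) (M₂≐M₃ i j K v)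

-- Both Δm(ij|K) = 0 and the CI equation p_{ijK} p_K = p_{iK} p_{jK} have this shape.
modelOf : ∀ {n} {T : Set} → (T → T → T → T → Set) → (Subset n → T) → Model n
modelOf Q F i j K = Q (F (⁅ i ⁆ ∪ ⁅ j ⁆ ∪ K)) (F K) (F (⁅ i ⁆ ∪ K)) (F (⁅ j ⁆ ∪ K))

Symmetric : ∀ {n} → Model n → Set
Symmetric M = ∀ i j K → Valid i j K → M i j K → M j i K

Exchange : ∀ {n} → Model n → Set
Exchange M = ∀ i j l K → i ≢ j → i ≢ l → j ≢ l → i ∉ K → j ∉ K → l ∉ K →
             M i j K × M i l (⁅ j ⁆ ∪ K) → M i l K × M i j (⁅ l ⁆ ∪ K)

module _ {m n} (ι : Fin m → Fin n) where

  inImage? : Decidable (InImage ι)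
  inImage? i = any? (λ a → ι a ≟ i)

  lookup-preimage : ∀ K a → lookup (preimage ι K) a ≡ lookup K (ι a)
  lookup-preimage K a = lookup∘tabulate (lookup K ∘ ι) a

  preimage-zipWith : ∀ f A B → preimage ι (zipWith f A B) ≡ zipWith f (preimage ι A) (preimage ι B)
  preimage-zipWith f A B = lookup-ext λ a → begin
    lookup (preimage ι (zipWith f A B)) a
      ≡⟨ lookup-preimage (zipWith f A B) a ⟩
    lookup (zipWith f A B) (ι a)
      ≡⟨ lookup-zipWith f (ι a) A B ⟩
    f (lookup A (ι a)) (lookup B (ι a))
      ≡⟨ sym (cong₂ f (lookup-preimage A a) (lookup-preimage B a)) ⟩
    f (lookup (preimage ι A) a) (lookup (preimage ι B) a)
      ≡⟨ sym (lookup-zipWith f a (preimage ι A) (preimage ι B)) ⟩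
    lookup (zipWith f (preimage ι A) (preimage ι B)) a ∎
    where open ≡-Reasoning

  preimage-∪ : ∀ A B → preimage ι (A ∪ B) ≡ preimage ι A ∪ preimage ι B
  preimage-∪ = preimage-zipWith _∨_

  preimage-∩ : ∀ A B → preimage ι (A ∩ B) ≡ preimage ι A ∩ preimage ι B
  preimage-∩ = preimage-zipWith _∧_

  preimage-replicate : ∀ b → preimage ι (replicate n b) ≡ replicate m b
  preimage-replicate b = lookup-ext λ a →
    trans (lookup-preimage (replicate n b) a)
          (trans (lookup-replicate (ι a) b) (sym (lookup-replicate a b)))

  preimage-∪-outside : ∀ {i} → ¬ InImage ι i → ∀ X → preimage ι (⁅ i ⁆ ∪ X) ≡ preimage ι X
  preimage-∪-outside {i} i∉ X = begin
    preimage ι (⁅ i ⁆ ∪ X)         ≡⟨ preimage-∪ ⁅ i ⁆ X ⟩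
    preimage ι ⁅ i ⁆ ∪ preimage ι X ≡⟨ cong (_∪ preimage ι X) preimage-⁅⁆ ⟩
    ⊥ ∪ preimage ι X                ≡⟨ ∪-identityˡ (preimage ι X) ⟩
    preimage ι X                    ∎
    where
    open ≡-Reasoning
    preimage-⁅⁆ : preimage ι ⁅ i ⁆ ≡ ⊥
    preimage-⁅⁆ = lookup-ext λ a → begin
      lookup (preimage ι ⁅ i ⁆) a ≡⟨ lookup-preimage ⁅ i ⁆ a ⟩
      lookup ⁅ i ⁆ (ι a)          ≡⟨ lookup-⁅⁆ i (ι a) ⟩
      does (i ≟ ι a)              ≡⟨ dec-false (i ≟ ι a) (λ i≡ιa → i∉ (a , sym i≡ιa)) ⟩
      false                       ≡⟨ sym (lookup-replicate a false) ⟩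
      lookup ⊥ a                  ∎

  ∉-preimage : ∀ {a K} → ι a ∉ K → a ∉ preimage ι K
  ∉-preimage {a} {K} ιa∉K a∈ = ιa∉K (lookup⇒[]= (ι a) K (trans (sym (lookup-preimage K a)) ([]=⇒lookup a∈)))

  valid-preimage : ∀ {a b K} → Valid (ι a) (ι b) K → Valid a b (preimage ι K)
  valid-preimage (ιa≢ιb , ιa∉K , ιb∉K) = (ιa≢ιb ∘ cong ι) , ∉-preimage ιa∉K , ∉-preimage ιb∉K

  lift-preimage-cong : ∀ (M : Model m) {i j} K K′ → preimage ι K ≡ preimage ι K′ →
                       lift ι M i j K → lift ι M i j K′
  lift-preimage-cong M K K′ e (inj₁ outside) = inj₁ outside
  lift-preimage-cong M K K′ e (inj₂ (a , b , ιa≡i , ιb≡j , Mab)) =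
    inj₂ (a , b , ιa≡i , ιb≡j , subst (M a b) e Mab)

module _ {m n} {ι : Fin m → Fin n} (ι-injective : Injective _≡_ _≡_ ι) where

  preimage-∪-image : ∀ a X → preimage ι (⁅ ι a ⁆ ∪ X) ≡ ⁅ a ⁆ ∪ preimage ι X
  preimage-∪-image a X = trans (preimage-∪ ι ⁅ ι a ⁆ X) (cong (_∪ preimage ι X) preimage-⁅⁆)
    where
    open ≡-Reasoning
    preimage-⁅⁆ : preimage ι ⁅ ι a ⁆ ≡ ⁅ a ⁆
    preimage-⁅⁆ = lookup-ext λ b → begin
      lookup (preimage ι ⁅ ι a ⁆) b ≡⟨ lookup-preimage ι ⁅ ι a ⁆ b ⟩
      lookup ⁅ ι a ⁆ (ι b)          ≡⟨ lookup-⁅⁆ (ι a) (ι b) ⟩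
      does (ι a ≟ ι b)              ≡⟨ does-injective a b ⟩
      does (a ≟ b)                  ≡⟨ sym (lookup-⁅⁆ a b) ⟩
      lookup ⁅ a ⁆ b                ∎
      where
      does-injective : ∀ a b → does (ι a ≟ ι b) ≡ does (a ≟ b)
      does-injective a b with a ≟ b
      ... | yes a≡b = dec-true (ι a ≟ ι b) (cong ι a≡b)
      ... | no a≢b  = dec-false (ι a ≟ ι b) (a≢b ∘ ι-injective)

  lift-image : ∀ (M : Model m) a b K → lift ι M (ι a) (ι b) K ⇔ M a b (preimage ι K)
  lift-image M a b K = mk⇔ to (λ Mab → inj₂ (a , b , refl , refl , Mab))
    where
    to : lift ι M (ι a) (ι b) K → M a b (preimage ι K)
    to (inj₁ (inj₁ ιa∉)) = ⊥-elim (ιa∉ (a , refl))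
    to (inj₁ (inj₂ ιb∉)) = ⊥-elim (ιb∉ (b , refl))
    to (inj₂ (a′ , b′ , ιa′≡ιa , ιb′≡ιb , Ma′b′)) with ι-injective ιa′≡ιa | ι-injective ιb′≡ιb
    ... | refl | refl = Ma′b′

  lift-modelOf : ∀ {T : Set} (Q : T → T → T → T → Set) →
                 (∀ u v → Q u v v u) → (∀ u v → Q u v u v) →
                 ∀ {M : Model m} {G : Subset m → T} →
                 M ≐ modelOf Q G → lift ι M ≐ modelOf Q (G ∘ preimage ι)
  lift-modelOf Q Q-swap Q-refl {M} {G} M≐ i j K v with inImage? ι i | inImage? ι j
  ... | no i∉ | _ = mk⇔ (const i-null) (const (inj₁ (inj₁ i∉)))
    where
    i-null : modelOf Q (G ∘ preimage ι) i j K
    i-null rewrite preimage-∪-outside ι i∉ (⁅ j ⁆ ∪ K) | preimage-∪-outside ι i∉ K = Q-swap _ _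
  ... | yes (a , refl) | no j∉ = mk⇔ (const j-null) (const (inj₁ (inj₂ j∉)))
    where
    j-null : modelOf Q (G ∘ preimage ι) (ι a) j K
    j-null rewrite preimage-∪-image a (⁅ j ⁆ ∪ K) | preimage-∪-image a K
                 | preimage-∪-outside ι j∉ K = Q-refl _ _
  ... | yes (a , refl) | yes (b , refl) =
    ⇔-trans (lift-image M a b K)
            (subst (M a b (preimage ι K) ⇔_) modelOf-image (M≐ a b (preimage ι K) (valid-preimage ι v)))
    where
    modelOf-image : modelOf Q G a b (preimage ι K) ≡ modelOf Q (G ∘ preimage ι) (ι a) (ι b) K
    modelOf-image rewrite preimage-∪-image a (⁅ ι b ⁆ ∪ K) | preimage-∪-image b K | preimage-∪-image a K = refl

  lift-symmetric : ∀ {M : Model m} → Symmetric M → Symmetric (lift ι M)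
  lift-symmetric M-sym i j K v (inj₁ (inj₁ i∉)) = inj₁ (inj₂ i∉)
  lift-symmetric M-sym i j K v (inj₁ (inj₂ j∉)) = inj₁ (inj₁ j∉)
  lift-symmetric M-sym _ _ K v (inj₂ (a , b , refl , refl , Mab)) =
    inj₂ (b , a , refl , refl , M-sym a b (preimage ι K) (valid-preimage ι v) Mab)

  lift-exchange : ∀ {M : Model m} → Exchange M → Exchange (lift ι M)
  lift-exchange {M} M-exchange i j l K i≢j i≢l j≢l i∉K j∉K l∉K (Lij , Lil)
    with inImage? ι i | inImage? ι j | inImage? ι l
  ... | no i∉ | _     | _     = inj₁ (inj₁ i∉) , inj₁ (inj₁ i∉)
  ... | yes _ | no j∉ | _     =
    lift-preimage-cong ι M (⁅ j ⁆ ∪ K) K (preimage-∪-outside ι j∉ K) Lil , inj₁ (inj₂ j∉)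
  ... | yes _ | yes _ | no l∉ =
    inj₁ (inj₂ l∉) , lift-preimage-cong ι M K (⁅ l ⁆ ∪ K) (sym (preimage-∪-outside ι l∉ K)) Lij
  ... | yes (a , refl) | yes (b , refl) | yes (c , refl) =
    lift-back (M-exchange a b c (preimage ι K) (i≢j ∘ cong ι) (i≢l ∘ cong ι) (j≢l ∘ cong ι)
                 (∉-preimage ι i∉K) (∉-preimage ι j∉K) (∉-preimage ι l∉K)
                 (to (lift-image M a b K) Lij ,
                  subst (M a c) (preimage-∪-image b K) (to (lift-image M a c (⁅ ι b ⁆ ∪ K)) Lil)))
    where
    open Equivalence
    lift-back : M a c (preimage ι K) × M a b (⁅ c ⁆ ∪ preimage ι K) →
                lift ι M (ι a) (ι c) K × lift ι M (ι a) (ι b) (⁅ ι c ⁆ ∪ K)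
    lift-back (Mac , Mab) =
      from (lift-image M a c K) Mac ,
      from (lift-image M a b (⁅ ι c ⁆ ∪ K)) (subst (M a b) (sym (preimage-∪-image c K)) Mab)

semigraphoid-closed : ClosedUnderLifting 𝔖
semigraphoid-closed m n ι ι-injective M (M-sym , M-axiom) =
  lift-symmetric ι-injective M-sym ,
  λ i j l K i≢j i≢l j≢l i∉K j∉K l∉K →
    mk⇔ (lift-exchange ι-injective exchange i j l K i≢j i≢l j≢l i∉K j∉K l∉K)
        (lift-exchange ι-injective exchange i l j K i≢l i≢j (j≢l ∘ sym) i∉K l∉K j∉K)
  where
  exchange : Exchange M
  exchange i j l K i≢j i≢l j≢l i∉K j∉K l∉K = Equivalence.to (M-axiom i j l K i≢j i≢l j≢l i∉K j∉K l∉K)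

module Structural (ℝ : RealField) where
  open RealField ℝ
  open IsCommutativeRing isCommutativeRing using (+-comm; -‿inverseʳ)

  ΔVanishes : Carrier → Carrier → Carrier → Carrier → Set
  ΔVanishes u v w t = (u + v) + - (w + t) ≡ 0#

  supermodular-preimage : ∀ {m n} (ι : Fin m → Fin n) {μ : Subset m → Carrier} →
                          Supermodular ℝ μ → Supermodular ℝ (μ ∘ preimage ι)
  supermodular-preimage ι {μ} μ-super A B =
    subst₂ (λ A∪B A∩B → μ (preimage ι A) + μ (preimage ι B) ≤ μ A∪B + μ A∩B)
           (sym (preimage-∪ ι A B)) (sym (preimage-∩ ι A B)) (μ-super (preimage ι A) (preimage ι B))

  structural-closed : ClosedUnderLifting (𝔖str ℝ)
  structural-closed m n ι ι-injective M (μ , μ-super , M≐) =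
    μ ∘ preimage ι , supermodular-preimage ι μ-super ,
    lift-modelOf ι-injective ΔVanishes
                 (λ u v → trans (cong (λ w → (u + v) + - w) (+-comm v u)) (-‿inverseʳ (u + v)))
                 (λ u v → -‿inverseʳ (u + v)) M≐

module Probability (ℝ : RealField) where
  open RealField ℝ
  open IsCommutativeRing isCommutativeRing using (+-isCommutativeMonoid; +-identityˡ; +-identityʳ; *-comm)
  open IsTotalOrder isTotalOrder using (reflexive) renaming (trans to ≤-trans)
  open ListSum +-isCommutativeMonoid
  open ≡-Reasoning

  infixl 8 _when_
  _when_ : Carrier → Bool → Carrier
  u when b = if b then u else 0#

  sum-when : ∀ {B : Set} (f : B → Carrier) xs b → sum (map f xs) when b ≡ sum (map (λ x → f x when b) xs)
  sum-when f xs true  = refl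
  sum-when f xs false = sym (sum-ε xs)

  when-∧ : ∀ u b c → u when (b ∧ c) ≡ u when c when b
  when-∧ u true  c = refl
  when-∧ u false c = refl

  when-comm : ∀ u b c → u when b when c ≡ u when c when b
  when-comm u true  c     = refl
  when-comm u false true  = refl
  when-comm u false false = refl

  when-nonneg : ∀ {u} b → 0# ≤ u → 0# ≤ u when b
  when-nonneg true  0≤u = 0≤u
  when-nonneg false _   = reflexive refl

  sum-nonneg : ∀ {B : Set} (f : B → Carrier) xs → (∀ x → 0# ≤ f x) → 0# ≤ sum (map f xs)
  sum-nonneg f []       _   = reflexive refl
  sum-nonneg f (x ∷ xs) f≥0 =
    ≤-trans (subst (0# ≤_) (sym (+-identityˡ _)) (sum-nonneg f xs f≥0)) (+-mono 0# (f x) _ (f≥0 x))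

  sum-δ-allFin : ∀ {N} (b : Fin N) (h : Fin N → Carrier) →
                 sum (map (λ a → h a when ⌊ b ≟ a ⌋) (allFin N)) ≡ h b
  sum-δ-allFin {suc N} b h = begin
    sum (map δ (allFin (suc N)))
      ≡⟨ cong (λ as → δ zero + sum as) (trans (map-tabulate suc δ) (sym (map-tabulate id (δ ∘ suc)))) ⟩
    δ zero + sum (map (δ ∘ suc) (allFin N))
      ≡⟨ split b ⟩
    h b ∎
    where
    δ : Fin (suc N) → Carrier
    δ a = h a when ⌊ b ≟ a ⌋
    split : ∀ b → h zero when ⌊ b ≟ zero ⌋ + sum (map (λ a → h (suc a) when ⌊ b ≟ suc a ⌋) (allFin N))
                  ≡ h b
    split zero    = trans (cong (h zero +_) (sum-ε (allFin N))) (+-identityʳ (h zero))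
    split (suc b) = begin
      0# + sum (map (λ a → h (suc a) when ⌊ suc b ≟ suc a ⌋) (allFin N))
        ≡⟨ +-identityˡ _ ⟩
      sum (map (λ a → h (suc a) when ⌊ suc b ≟ suc a ⌋) (allFin N))
        ≡⟨ cong sum (map-cong (λ a → cong (h (suc a) when_) (⌊⌋-map′ (cong suc) _ (b ≟ a))) (allFin N)) ⟩
      sum (map (λ a → h (suc a) when ⌊ b ≟ a ⌋) (allFin N))
        ≡⟨ sum-δ-allFin b (h ∘ suc) ⟩
      h (suc b) ∎

  Agree : ∀ {n k} → Subset n → Config ℝ n k → Config ℝ n k → Set
  Agree I x y = ∀ i → T (lookup I i) → x i ≡ y i

  T-agreeOn : ∀ {n k} (I : Subset n) (x y : Config ℝ n k) → T (agreeOn ℝ I x y) ⇔ Agree I x y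
  T-agreeOn {n} I x y = mk⇔
    (λ t i → Equivalence.to (T-if-⌊⌋ (lookup I i) (x i ≟ y i)) (tabulate⁻ (all⁺ agreeAt (allFin n) t) i))
    (λ h → all⁻ agreeAt (tabulate⁺ (λ i → Equivalence.from (T-if-⌊⌋ (lookup I i) (x i ≟ y i)) (h i))))
    where
    agreeAt : Fin n → Bool
    agreeAt i = if lookup I i then ⌊ x i ≟ y i ⌋ else true

  Agree-sym : ∀ {n k} {I : Subset n} {x y : Config ℝ n k} → Agree I x y ⇔ Agree I y x
  Agree-sym = mk⇔ (λ h i i∈ → sym (h i i∈)) (λ h i i∈ → sym (h i i∈))

  agreeOn-cong : ∀ {n n′ k k′} (I : Subset n) (J : Subset n′)
                 {x y : Config ℝ n k} {x′ y′ : Config ℝ n′ k′} →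
                 (Agree I x y ⇔ Agree J x′ y′) → agreeOn ℝ I x y ≡ agreeOn ℝ J x′ y′
  agreeOn-cong I J {x} {y} {x′} {y′} A⇔A =
    T-injective (⇔-trans (T-agreeOn I x y) (⇔-trans A⇔A (⇔-sym (T-agreeOn J x′ y′))))

  Agree-⊤ : ∀ {n k} {x y : Config ℝ n k} → Agree ⊤ x y ⇔ (∀ i → x i ≡ y i)
  Agree-⊤ = mk⇔ (λ h i → h i (subst T (sym (lookup-replicate i true)) tt)) (λ h i _ → h i)

  agreeOn-⊥ : ∀ {n k} (x y : Config ℝ n k) → agreeOn ℝ ⊥ x y ≡ true
  agreeOn-⊥ x y = Equivalence.to T-≡ (Equivalence.from (T-agreeOn ⊥ x y)
    (λ i i∈⊥ → ⊥-elim (subst T (lookup-replicate i false) i∈⊥)))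

  agreeOn-resp : ∀ {n k} (I : Subset n) {x x′ y y′ : Config ℝ n k} →
                 (∀ i → x i ≡ x′ i) → (∀ i → y i ≡ y′ i) → agreeOn ℝ I x y ≡ agreeOn ℝ I x′ y′
  agreeOn-resp I x≗x′ y≗y′ = agreeOn-cong I I (mk⇔
    (λ h i i∈I → trans (sym (x≗x′ i)) (trans (h i i∈I) (y≗y′ i)))
    (λ h i i∈I → trans (x≗x′ i) (trans (h i i∈I) (sym (y≗y′ i)))))

  T-agreeOn-⊤ : ∀ {n k} {x y : Config ℝ n k} → T (agreeOn ℝ ⊤ x y) ⇔ (∀ i → x i ≡ y i)
  T-agreeOn-⊤ {x = x} {y} = ⇔-trans (T-agreeOn ⊤ x y) Agree-⊤

  Extensional : ∀ {n k} → (Config ℝ n k → Carrier) → Set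
  Extensional G = ∀ {y y′} → (∀ i → y i ≡ y′ i) → G y ≡ G y′

  -- allConfigs is built from a where-local cons that cannot be named here, so its
  -- inductive step is proved for any function obeying the defining equations of cons.
  module ConsStep {N} {κ : Fin (suc N) → ℕ}
                  (cons : Fin (suc (κ zero)) → Config ℝ N (κ ∘ suc) → Config ℝ (suc N) κ)
                  (cons-zero : ∀ a r → cons a r zero ≡ a)
                  (cons-suc : ∀ a r i → cons a r (suc i) ≡ r i) where

    cons-cong : ∀ a {r r′} → (∀ i → r i ≡ r′ i) → ∀ i → cons a r i ≡ cons a r′ i
    cons-cong a {r} {r′} r≗r′ zero    = trans (cons-zero a r) (sym (cons-zero a r′))
    cons-cong a {r} {r′} r≗r′ (suc i) = trans (cons-suc a r i) (trans (r≗r′ i) (sym (cons-suc a r′ i)))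

    cons-head-tail : ∀ x i → cons (x zero) (x ∘ suc) i ≡ x i
    cons-head-tail x zero    = cons-zero (x zero) (x ∘ suc)
    cons-head-tail x (suc i) = cons-suc (x zero) (x ∘ suc) i

    ≗-cons : ∀ x a r → (∀ i → x i ≡ cons a r i) ⇔ (T ⌊ x zero ≟ a ⌋ × T (agreeOn ℝ ⊤ (x ∘ suc) r))
    ≗-cons x a r = mk⇔
      (λ x≗ar → fromWitness (trans (x≗ar zero) (cons-zero a r)) ,
                Equivalence.from T-agreeOn-⊤ (λ i → trans (x≗ar (suc i)) (cons-suc a r i)))
      (λ (x₀≡a , x′≈r) → λ
        { zero    → trans (toWitness x₀≡a) (sym (cons-zero a r))
        ; (suc i) → trans (Equivalence.to T-agreeOn-⊤ x′≈r i) (sym (cons-suc a r i)) })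

    agreeOn-⊤-cons : ∀ x a r → agreeOn ℝ ⊤ x (cons a r) ≡ ⌊ x zero ≟ a ⌋ ∧ agreeOn ℝ ⊤ (x ∘ suc) r
    agreeOn-⊤-cons x a r = T-injective (⇔-trans T-agreeOn-⊤ (⇔-trans (≗-cons x a r) (⇔-sym T-∧)))

    sum-δ-step :
      (∀ (G′ : Config ℝ N (κ ∘ suc) → Carrier) → Extensional G′ → ∀ x′ →
         sum (map (λ r → G′ r when agreeOn ℝ ⊤ x′ r) (allConfigs ℝ N (κ ∘ suc))) ≡ G′ x′) →
      ∀ (G : Config ℝ (suc N) κ → Carrier) → Extensional G → ∀ x →
        sum (map (λ y → G y when agreeOn ℝ ⊤ x y)
                 (concatMap (λ a → map (cons a) (allConfigs ℝ N (κ ∘ suc))) (allFin (suc (κ zero))))) ≡ G x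
    sum-δ-step sum-δ G G-ext x = begin
      sum (map H (concatMap (λ a → map (cons a) R) A))
        ≡⟨ sum-concatMap (λ a → map (cons a) R) H A ⟩
      sum (map (λ a → sum (map H (map (cons a) R))) A)
        ≡⟨ cong sum (map-cong (λ a → cong sum (trans (sym (map-∘ R)) (map-cong (H-cons a) R))) A) ⟩
      sum (map (λ a → sum (map (λ r → G (cons a r) when agreeOn ℝ ⊤ (x ∘ suc) r when ⌊ x zero ≟ a ⌋) R)) A)
        ≡⟨ cong sum (map-cong (λ a → sym (sum-when (λ r → G (cons a r) when agreeOn ℝ ⊤ (x ∘ suc) r) R _)) A) ⟩
      sum (map (λ a → sum (map (λ r → G (cons a r) when agreeOn ℝ ⊤ (x ∘ suc) r) R) when ⌊ x zero ≟ a ⌋) A)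
        ≡⟨ cong sum (map-cong (λ a → cong (_when ⌊ x zero ≟ a ⌋)
                                          (sum-δ (G ∘ cons a) (G-ext ∘ cons-cong a) (x ∘ suc))) A) ⟩
      sum (map (λ a → G (cons a (x ∘ suc)) when ⌊ x zero ≟ a ⌋) A)
        ≡⟨ sum-δ-allFin (x zero) (λ a → G (cons a (x ∘ suc))) ⟩
      G (cons (x zero) (x ∘ suc))
        ≡⟨ G-ext (cons-head-tail x) ⟩
      G x ∎
      where
      A : List (Fin (suc (κ zero)))
      A = allFin (suc (κ zero))
      R : List (Config ℝ N (κ ∘ suc))
      R = allConfigs ℝ N (κ ∘ suc)
      H : Config ℝ (suc N) κ → Carrier
      H y = G y when agreeOn ℝ ⊤ x y
      H-cons : ∀ a r → H (cons a r) ≡ G (cons a r) when agreeOn ℝ ⊤ (x ∘ suc) r when ⌊ x zero ≟ a ⌋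
      H-cons a r = trans (cong (G (cons a r) when_) (agreeOn-⊤-cons x a r))
                         (when-∧ (G (cons a r)) ⌊ x zero ≟ a ⌋ (agreeOn ℝ ⊤ (x ∘ suc) r))

  sum-δ-allConfigs : ∀ N κ (G : Config ℝ N κ → Carrier) → Extensional G →
                     ∀ x → sum (map (λ y → G y when agreeOn ℝ ⊤ x y) (allConfigs ℝ N κ)) ≡ G x
  sum-δ-allConfigs zero    κ G G-ext x = trans (+-identityʳ _) (G-ext (λ ()))
  sum-δ-allConfigs (suc N) κ =
    ConsStep.sum-δ-step _ (λ _ _ → refl) (λ _ _ _ → refl) (sum-δ-allConfigs N (κ ∘ suc))

  marginalOf : ∀ {n} (k : Fin n → ℕ) → (Config ℝ n k → Carrier) → Subset n → Config ℝ n k → Carrier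
  marginalOf {n} k q I x = sum (map (λ y → q y when agreeOn ℝ I x y) (allConfigs ℝ n k))

  marginalOf-⊥ : ∀ {n} (k : Fin n → ℕ) (q : Config ℝ n k → Carrier) x →
                 marginalOf k q ⊥ x ≡ sum (map q (allConfigs ℝ n k))
  marginalOf-⊥ {n} k q x = cong sum (map-cong (λ y → cong (q y when_) (agreeOn-⊥ x y)) (allConfigs ℝ n k))

  marginal-resp : ∀ {n} (ξ : RandomVector ℝ n) I {x x′} →
                  (∀ i → x i ≡ x′ i) → marginal ℝ ξ I x ≡ marginal ℝ ξ I x′
  marginal-resp {n} ξ I x≗x′ =
    cong sum (map-cong (λ y → cong (p y when_) (agreeOn-resp I x≗x′ (λ _ → refl))) (allConfigs ℝ n k))
    where open RandomVector ξ

  CIEquation : {X : Set} → (X → Carrier) → (X → Carrier) → (X → Carrier) → (X → Carrier) → Set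
  CIEquation f g h l = ∀ x → f x * g x ≡ h x * l x

  CIEquation-cong : ∀ {X : Set} {f f′ g g′ h h′ l l′ : X → Carrier} → f ≗ f′ → g ≗ g′ → h ≗ h′ → l ≗ l′ →
                    CIEquation f g h l ⇔ CIEquation f′ g′ h′ l′
  CIEquation-cong f≗f′ g≗g′ h≗h′ l≗l′ = mk⇔
    (λ fg≡hl x → trans (sym (cong₂ _*_ (f≗f′ x) (g≗g′ x)))
                       (trans (fg≡hl x) (cong₂ _*_ (h≗h′ x) (l≗l′ x))))
    (λ fg≡hl x → trans (cong₂ _*_ (f≗f′ x) (g≗g′ x))
                       (trans (fg≡hl x) (sym (cong₂ _*_ (h≗h′ x) (l≗l′ x)))))

  modelOf-CIEquation-cong : ∀ {n} {X : Set} {F F′ : Subset n → X → Carrier} →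
                            (∀ J → F J ≗ F′ J) → modelOf CIEquation F ≐ modelOf CIEquation F′
  modelOf-CIEquation-cong F≗F′ i j K _ = CIEquation-cong (F≗F′ _) (F≗F′ _) (F≗F′ _) (F≗F′ _)

  module LiftedVector {m n} {ι : Fin m → Fin n} (ι-injective : Injective _≡_ _≡_ ι) (ξ : RandomVector ℝ m) where
    open RandomVector ξ

    sizeAt : ∀ {i} → Dec (InImage ι i) → ℕ
    sizeAt (yes (a , _)) = k a
    sizeAt (no _)        = 0

    -- Components outside the image get the one-point sample space Fin (suc 0).
    k′ : Fin n → ℕ
    k′ i = sizeAt (inImage? ι i)

    sizeAt-image : ∀ a (d : Dec (InImage ι (ι a))) → sizeAt d ≡ k a
    sizeAt-image a (yes (a′ , ιa′≡ιa)) = cong k (ι-injective ιa′≡ιa)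
    sizeAt-image a (no ιa∉)            = ⊥-elim (ιa∉ (a , refl))

    restrict : Config ℝ n k′ → Config ℝ m k
    restrict y a = cast (cong suc (sizeAt-image a (inImage? ι (ι a)))) (y (ι a))

    extendAt : Config ℝ m k → ∀ {i} (d : Dec (InImage ι i)) → Fin (suc (sizeAt d))
    extendAt z (yes (a , _)) = z a
    extendAt z (no _)        = zero

    extend : Config ℝ m k → Config ℝ n k′
    extend z i = extendAt z (inImage? ι i)

    toℕ-extend-image : ∀ z a → toℕ (extend z (ι a)) ≡ toℕ (z a)
    toℕ-extend-image z a = go (inImage? ι (ι a))
      where
      go : (d : Dec (InImage ι (ι a))) → toℕ (extendAt z d) ≡ toℕ (z a)
      go (yes (a′ , ιa′≡ιa)) = cong (toℕ ∘ z) (ι-injective ιa′≡ιa)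
      go (no ιa∉)            = ⊥-elim (ιa∉ (a , refl))

    ≡-extend⇔restrict-≡ : ∀ x z a → x (ι a) ≡ extend z (ι a) ⇔ restrict x a ≡ z a
    ≡-extend⇔restrict-≡ x z a = mk⇔
      (λ e → toℕ-injective (trans (toℕ-cast _ (x (ι a))) (trans (cong toℕ e) (toℕ-extend-image z a))))
      (λ e → toℕ-injective (trans (sym (toℕ-cast _ (x (ι a)))) (trans (cong toℕ e) (sym (toℕ-extend-image z a)))))

    restrict-extend : ∀ z a → restrict (extend z) a ≡ z a
    restrict-extend z a = Equivalence.to (≡-extend⇔restrict-≡ (extend z) z a) refl

    outside-constant : ∀ {i} → ¬ InImage ι i → (u v : Fin (suc (k′ i))) → u ≡ v
    outside-constant {i} i∉ = go (inImage? ι i)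
      where
      go : (d : Dec (InImage ι i)) (u v : Fin (suc (sizeAt d))) → u ≡ v
      go (yes i∈) _    _    = ⊥-elim (i∉ i∈)
      go (no _)   zero zero = refl

    agree-extend : ∀ I x z → Agree I x (extend z) ⇔ Agree (preimage ι I) (restrict x) z
    agree-extend I x z = mk⇔
      (λ h a a∈ → Equivalence.to (≡-extend⇔restrict-≡ x z a) (h (ι a) (subst T (lookup-preimage ι I a) a∈)))
      (λ h i → agreeAt h i (inImage? ι i))
      where
      agreeAt : Agree (preimage ι I) (restrict x) z → ∀ i → Dec (InImage ι i) → T (lookup I i) → x i ≡ extend z i
      agreeAt h _ (yes (a , refl)) ιa∈ =
        Equivalence.from (≡-extend⇔restrict-≡ x z a) (h a (subst T (sym (lookup-preimage ι I a)) ιa∈))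
      agreeAt h i (no i∉) _ = outside-constant i∉ (x i) (extend z i)

    agreeOn-restrict : ∀ y z → agreeOn ℝ ⊤ (restrict y) z ≡ agreeOn ℝ ⊤ (extend z) y
    agreeOn-restrict y z = agreeOn-cong ⊤ ⊤ (⇔-trans (⇔-sym agree-extend-⊤) (Agree-sym {I = ⊤}))
      where
      agree-extend-⊤ : Agree ⊤ y (extend z) ⇔ Agree ⊤ (restrict y) z
      agree-extend-⊤ = subst (λ I → Agree ⊤ y (extend z) ⇔ Agree I (restrict y) z)
                             (preimage-replicate ι true) (agree-extend ⊤ y z)

    -- Morally p′ y = p (restrict y); the sum form is needed because p, an
    -- arbitrary function on configurations, need not respect pointwise equality.
    p′ : Config ℝ n k′ → Carrier
    p′ y = sum (map (λ z → p z when agreeOn ℝ ⊤ (restrict y) z) (allConfigs ℝ m k))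

    marginal-restrict : ∀ J x → marginalOf k′ p′ J x ≡ marginal ℝ ξ (preimage ι J) (restrict x)
    marginal-restrict J x = begin
      sum (map (λ y → p′ y when agreeOn ℝ J x y) Cn)
        ≡⟨ cong sum (map-cong (λ y → sum-when _ Cm (agreeOn ℝ J x y)) Cn) ⟩
      sum (map (λ y → sum (map (λ z → F y z) Cm)) Cn)
        ≡⟨ sum-swap F Cn Cm ⟩
      sum (map (λ z → sum (map (λ y → F y z) Cn)) Cm)
        ≡⟨ cong sum (map-cong (λ z → cong sum (map-cong (F-δ z) Cn)) Cm) ⟩
      sum (map (λ z → sum (map (λ y → p z when agreeOn ℝ J x y when agreeOn ℝ ⊤ (extend z) y) Cn)) Cm)
        ≡⟨ cong sum (map-cong (λ z → sum-δ-allConfigs n k′ (λ y → p z when agreeOn ℝ J x y)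
                                      (cong (p z when_) ∘ agreeOn-resp J (λ _ → refl)) (extend z)) Cm) ⟩
      sum (map (λ z → p z when agreeOn ℝ J x (extend z)) Cm)
        ≡⟨ cong sum (map-cong (λ z → cong (p z when_) (agreeOn-cong J (preimage ι J) (agree-extend J x z))) Cm) ⟩
      sum (map (λ z → p z when agreeOn ℝ (preimage ι J) (restrict x) z) Cm) ∎
      where
      Cn : List (Config ℝ n k′)
      Cn = allConfigs ℝ n k′
      Cm : List (Config ℝ m k)
      Cm = allConfigs ℝ m k
      F : Config ℝ n k′ → Config ℝ m k → Carrier
      F y z = p z when agreeOn ℝ ⊤ (restrict y) z when agreeOn ℝ J x y
      F-δ : ∀ z y → F y z ≡ p z when agreeOn ℝ J x y when agreeOn ℝ ⊤ (extend z) y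
      F-δ z y = trans (cong (λ b → p z when b when agreeOn ℝ J x y) (agreeOn-restrict y z))
                      (when-comm (p z) (agreeOn ℝ ⊤ (extend z) y) (agreeOn ℝ J x y))

    p′-sum : sum (map p′ (allConfigs ℝ n k′)) ≡ 1#
    p′-sum = begin
      sum (map p′ (allConfigs ℝ n k′))           ≡⟨ sym (marginalOf-⊥ k′ p′ x₀) ⟩
      marginalOf k′ p′ ⊥ x₀                     ≡⟨ marginal-restrict ⊥ x₀ ⟩
      marginal ℝ ξ (preimage ι ⊥) (restrict x₀) ≡⟨ cong (λ I → marginal ℝ ξ I (restrict x₀))
                                                         (preimage-replicate ι false) ⟩
      marginal ℝ ξ ⊥ (restrict x₀)              ≡⟨ marginalOf-⊥ k p (restrict x₀) ⟩
      sum (map p (allConfigs ℝ m k))             ≡⟨ sum≡1 ⟩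
      1#                                         ∎
      where
      x₀ : Config ℝ n k′
      x₀ _ = zero

    lifted : RandomVector ℝ n
    lifted = record
      { k     = k′
      ; p     = p′
      ; p≥0   = λ y → sum-nonneg _ (allConfigs ℝ m k) (λ z → when-nonneg _ (p≥0 z))
      ; sum≡1 = p′-sum
      }

    CI-restrict : CI ℝ ξ ≐ modelOf CIEquation (λ J → marginal ℝ ξ J ∘ restrict)
    CI-restrict a b L v = mk⇔ (λ h → h ∘ restrict) (λ h →
      Equivalence.to (modelOf-CIEquation-cong (λ J z → marginal-resp ξ J (restrict-extend z)) a b L v)
                     (h ∘ extend))

    CI-lifted : modelOf CIEquation (λ J → marginal ℝ ξ (preimage ι J) ∘ restrict) ≐ CI ℝ lifted
    CI-lifted = modelOf-CIEquation-cong (λ J x → sym (marginal-restrict J x))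

  probabilistic-closed : ClosedUnderLifting (𝔓 ℝ)
  probabilistic-closed m n ι ι-injective M (ξ , M≐CI) =
    lifted ,
    ≐-trans (lift-modelOf ι-injective CIEquation (λ f g x → *-comm (f x) (g x)) (λ f g x → refl)
                          (≐-trans M≐CI CI-restrict))
            CI-lifted
    where open LiftedVector ι-injective ξ

lemma4p10 : (ℝ : RealField) →
    ClosedUnderLifting (𝔓 ℝ) × ClosedUnderLifting (𝔖str ℝ) × ClosedUnderLifting 𝔖
lemma4p10 ℝ = Probability.probabilistic-closed ℝ , Structural.structural-closed ℝ , semigraphoid-closed
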